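{- Let $r\ge 2$, let $F_1,\dots,F_n$ be matchings, each of size $n$, in an $r$-uniform hypergraph. Let $R$ be a rainbow matching of maximum possible size $q$, with a fixed injection $\phi:R\to[n]$ satisfying $e\in F_{\phi(e)}$ for all $e\in R$, and let $J=[n]\setminus\phi(R)$. For $e\in R$ let $T(e)$ be the set of indices $j\in J$ such that $F_j$ contains $r$ edges each of which intersects $e$ and intersects no other edge of $R$. Then $|T(e)|\le r$ for every $e\in R$.
   Context: A rainbow matching is a matching $M$ together with an injection $\psi:M\to[n]$ with $x\in F_{\psi(x)}$ for every $x\in M$; "maximum possible size" is over all rainbow matchings. The family $(F_1,\dots,F_n)$ may contain repeated matchings. -}

module Defs where

open import Data.Nat using (ℕ; _≤_)
open import Data.Fin using (Fin)
open import Data.Fin.Subset using (Subset; _∩_; ∣_∣; Nonempty; Empty)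
open import Data.Product using (Σ; ∃; _×_)
open import Relation.Binary.PropositionalEquality using (_≡_; _≢_)
open import Function.Definitions using (Injective)

-- Vertices of the hypergraph are Fin m; an edge is a subset of Fin m.
Meets : ∀ {m} → Subset m → Subset m → Set
Meets A B = Nonempty (A ∩ B)

Disjoint : ∀ {m} → Subset m → Subset m → Set
Disjoint A B = Empty (A ∩ B)

-- A matching of size n in an r-uniform hypergraph, given as n edges indexed
-- by Fin n, each of size r, pairwise disjoint (hence pairwise distinct, as r ≥ 1).
IsMatchingOfSize : ∀ {m} (r n : ℕ) → (Fin n → Subset m) → Set
IsMatchingOfSize r n M =
  (∀ i → ∣ M i ∣ ≡ r) × (∀ i j → i ≢ j → Disjoint (M i) (M j))

-- The family (F_1,…,F_n): F i is the i-th matching, F i j its j-th edge.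
Family : ℕ → ℕ → Set
Family m n = Fin n → Fin n → Subset m

IsRainbow : ∀ {m n} → Family m n → (q : ℕ) → (Fin q → Subset m) → (Fin q → Fin n) → Set
IsRainbow F q R φ =
  Injective _≡_ _≡_ φ ×
  (∀ k k′ → k ≢ k′ → Disjoint (R k) (R k′)) ×
  (∀ k → ∃ λ j → F (φ k) j ≡ R k)

IsMaxRainbowSize : ∀ {m n} → Family m n → ℕ → Set
IsMaxRainbowSize {m} {n} F q =
  ∀ q′ (R′ : Fin q′ → Subset m) (φ′ : Fin q′ → Fin n) → IsRainbow F q′ R′ φ′ → q′ ≤ q

InJ : ∀ {q n} → (Fin q → Fin n) → Fin n → Set
InJ φ j = ∀ k → φ k ≢ j

InT : ∀ {m n q} (r : ℕ) → Family m n → (Fin q → Subset m) → (Fin q → Fin n) →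
      Fin q → Fin n → Set
InT {n = n} r F R φ k j =
  InJ φ j ×
  Σ (Fin r → Fin n) λ g → Injective _≡_ _≡_ g ×
    (∀ t → Meets (R k) (F j (g t)) × (∀ k′ → k′ ≢ k → Disjoint (R k′) (F j (g t))))

-- Write e for the edge R k and, for the i-th index of T(e), let E i 1, …, E i r be the r
-- edges of its matching. If some E i t and E i′ t′ with i ≠ i′ were disjoint, removing e
-- from R and adding both would give a larger rainbow matching, so edges belonging to
-- different indices always meet. Pigeonhole: r pairwise disjoint sets meeting an r-set S
-- meet it in one point each and cover it. Applied to S = e (with r ≥ 2) it yields a point x of
-- E 1 1 outside e; applied to S = E 1 1 it yields, for each i, an edge E i (T i)
-- through x. The point of e on E i (T i) determines i: two such edges share x, so a
-- second common point in e contradicts the pigeonhole for S = E i (T i). Hence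
-- |T(e)| ≤ |e| = r.
module Submission where

open import Data.Nat using (ℕ; zero; suc; _≤_; z≤n)
open import Data.Nat.Properties using (≤-trans; ≤-reflexive; n≮n)
open import Data.Fin using (Fin; zero; suc; punchIn)
open import Data.Fin.Properties using (injective⇒≤; suc-injective; any?; punchIn-injective; punchInᵢ≢i)
  renaming (_≟_ to _≟ᶠ_)
open import Data.Fin.Subset using (Subset; _∈_; _∉_; ∣_∣; _∩_; ⁅_⁆; _⊆_)
open import Data.Fin.Subset.Properties
  using (_∈?_; x∈p∩q⁺; x∈p∩q⁻; nonempty?; p⊆q⇒∣p∣≤∣q∣; ∣⁅x⁆∣≡1; x∈⁅x⁆)
open import Data.Bool using (true; false)
open import Data.Vec.Base using (_∷_; here; there)
open import Data.Vec.Functional using (Vector; updateAt) renaming (_∷_ to _◂_)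
open import Data.Vec.Functional.Properties using (updateAt-updates; updateAt-minimal)
open import Data.Product using (∃; _×_; _,_; proj₁; proj₂; swap)
open import Function using (_∘_; const)
open import Function.Definitions using (Injective)
open import Relation.Nullary using (yes; no; ¬?; contradiction)
open import Relation.Nullary.Decidable using (_×-dec_)
open import Relation.Binary.PropositionalEquality using (_≡_; _≢_; refl; sym; trans; cong; subst)

open import Defs

◂-injective : ∀ {a} {A : Set a} {n} {x : A} {xs : Vector A n} →
              (∀ i → xs i ≢ x) → Injective _≡_ _≡_ xs → Injective _≡_ _≡_ (x ◂ xs)
◂-injective fresh inj {zero}  {zero}  _  = refl
◂-injective fresh inj {zero}  {suc j} eq = contradiction (sym eq) (fresh j)
◂-injective fresh inj {suc i} {zero}  eq = contradiction eq (fresh i)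
◂-injective fresh inj {suc i} {suc j} eq = cong suc (inj eq)

rank : ∀ {m} (S : Subset m) {x : Fin m} → x ∈ S → Fin ∣ S ∣
rank (true  ∷ S) here      = zero
rank (true  ∷ S) (there p) = suc (rank S p)
rank (false ∷ S) (there p) = rank S p

rank-injective : ∀ {m} (S : Subset m) {x y : Fin m} (p : x ∈ S) (q : y ∈ S) →
                 rank S p ≡ rank S q → x ≡ y
rank-injective (true  ∷ S) here      here      _  = refl
rank-injective (true  ∷ S) (there p) (there q) eq = cong suc (rank-injective S p q (suc-injective eq))
rank-injective (false ∷ S) (there p) (there q) eq = cong suc (rank-injective S p q eq)

injection⇒≤∣∣ : ∀ {m a} (S : Subset m) (f : Fin a → Fin m) →
                Injective _≡_ _≡_ f → (∀ t → f t ∈ S) → a ≤ ∣ S ∣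
injection⇒≤∣∣ S f inj f∈S = injective⇒≤ (inj ∘ rank-injective S (f∈S _) (f∈S _))

injection-onto : ∀ {m r} (S : Subset m) → ∣ S ∣ ≡ r → (f : Fin r → Fin m) →
                 Injective _≡_ _≡_ f → (∀ t → f t ∈ S) → ∀ {y} → y ∈ S → ∃ λ t → f t ≡ y
injection-onto {r = r} S ∣S∣≡r f inj f∈S {y} y∈S with any? (λ t → f t ≟ᶠ y)
... | yes hit = hit
... | no miss = contradiction (≤-trans r<∣S∣ (≤-reflexive ∣S∣≡r)) (n≮n r)
  where
  y◂f∈S : ∀ t → (y ◂ f) t ∈ S
  y◂f∈S zero    = y∈S
  y◂f∈S (suc t) = f∈S t
  r<∣S∣ : suc r ≤ ∣ S ∣
  r<∣S∣ = injection⇒≤∣∣ S (y ◂ f) (◂-injective (λ t ft≡y → miss (t , ft≡y)) inj) y◂f∈S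

Disjoint-sym : ∀ {m} {A B : Subset m} → Disjoint A B → Disjoint B A
Disjoint-sym {A = A} {B} A∩B≡∅ (x , x∈B∩A) = A∩B≡∅ (x , x∈p∩q⁺ (swap (x∈p∩q⁻ B A x∈B∩A)))

Disjoint⇒≢ : ∀ {m} {A B : Subset m} {x y : Fin m} → Disjoint A B → x ∈ A → y ∈ B → x ≢ y
Disjoint⇒≢ A∩B≡∅ x∈A y∈B refl = A∩B≡∅ (_ , x∈p∩q⁺ (x∈A , y∈B))

∃∈∖-of-single-meeting : ∀ {m} {A B : Subset m} {u : Fin m} → 2 ≤ ∣ A ∣ → u ∈ A →
                        (∀ {y} → y ∈ A → y ∈ B → y ≡ u) → ∃ λ x → x ∈ A × x ∉ B
∃∈∖-of-single-meeting {A = A} {B} {u} 2≤∣A∣ u∈A A∩B⊆u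
  with any? (λ y → (y ∈? A) ×-dec ¬? (y ∈? B))
... | yes found = found
... | no none   = contradiction (≤-trans 2≤∣A∣ (≤-trans (p⊆q⇒∣p∣≤∣q∣ A⊆u) (≤-reflexive (∣⁅x⁆∣≡1 u)))) (n≮n 1)
  where
  A⊆u : A ⊆ ⁅ u ⁆
  A⊆u {y} y∈A with y ∈? B
  ... | yes y∈B = subst (_∈ ⁅ u ⁆) (sym (A∩B⊆u y∈A y∈B)) (x∈⁅x⁆ u)
  ... | no  y∉B = contradiction (y , y∈A , y∉B) none

module Transversal {m r : ℕ} (S : Subset m) (∣S∣≡r : ∣ S ∣ ≡ r) (P : Fin r → Subset m)
  (P-disjoint : ∀ t t′ → t ≢ t′ → Disjoint (P t) (P t′)) (S-meets : ∀ t → Meets S (P t)) where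

  private
    choice-injective : (f : Fin r → Fin m) → (∀ t → f t ∈ P t) → Injective _≡_ _≡_ f
    choice-injective f f∈P {t} {t′} ft≡ft′ with t ≟ᶠ t′
    ... | yes t≡t′ = t≡t′
    ... | no  t≢t′ = contradiction ft≡ft′ (Disjoint⇒≢ (P-disjoint t t′ t≢t′) (f∈P t) (f∈P t′))

    point : Fin r → Fin m
    point t = proj₁ (S-meets t)

    point∈ : ∀ t → point t ∈ S × point t ∈ P t
    point∈ t = x∈p∩q⁻ S (P t) (proj₂ (S-meets t))

  covers : ∀ {y} → y ∈ S → ∃ λ t → y ∈ P t
  covers y∈S with injection-onto S ∣S∣≡r point (choice-injective point (proj₂ ∘ point∈)) (proj₁ ∘ point∈) y∈S
  ... | t , refl = t , proj₂ (point∈ t)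

  meets-once : ∀ {t y z} → y ∈ P t → y ∈ S → z ∈ P t → z ∈ S → y ≡ z
  meets-once {t} {y} {z} y∈P y∈S z∈P z∈S
    with injection-onto S ∣S∣≡r point′ (choice-injective point′ (proj₂ ∘ point′∈)) (proj₁ ∘ point′∈) y∈S
    where
    point′ : Fin r → Fin m
    point′ = updateAt point t (const z)
    point′∈ : ∀ t′ → point′ t′ ∈ S × point′ t′ ∈ P t′
    point′∈ t′ with t′ ≟ᶠ t
    ... | yes refl rewrite updateAt-updates t {const z} point = z∈S , z∈P
    ... | no  t′≢t rewrite updateAt-minimal t′ t {const z} point t′≢t = point∈ t′
  ... | t′ , point′t′≡y with t′ ≟ᶠ t
  ...   | yes refl = trans (sym point′t′≡y) (updateAt-updates t point)
  ...   | no  t′≢t = contradiction (trans (sym (updateAt-minimal t′ t point t′≢t)) point′t′≡y)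
                       (Disjoint⇒≢ (P-disjoint t′ t t′≢t) (proj₂ (point∈ t′)) y∈P)

cross-intersecting-matchings≤ : ∀ {m r s} {e : Subset m} → 2 ≤ r → ∣ e ∣ ≡ r →
  (E : Fin s → Fin r → Subset m) → (∀ i t → ∣ E i t ∣ ≡ r) →
  (∀ i t t′ → t ≢ t′ → Disjoint (E i t) (E i t′)) → (∀ i t → Meets e (E i t)) →
  (∀ i i′ t t′ → i ≢ i′ → Meets (E i t) (E i′ t′)) → s ≤ r
cross-intersecting-matchings≤ {s = zero} _ _ _ _ _ _ _ = z≤n
cross-intersecting-matchings≤ {m} {r@(suc _)} {suc s} {e} 2≤r ∣e∣≡r E ∣E∣≡r E-disjoint e-meets cross =
  ≤-trans (injection⇒≤∣∣ e c c-injective (proj₁ ∘ c∈)) (≤-reflexive ∣e∣≡r)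
  where
  module Through (i : Fin (suc s)) (t : Fin r) (i′ : Fin (suc s)) (i≢i′ : i ≢ i′) =
    Transversal (E i t) (∣E∣≡r i t) (E i′) (E-disjoint i′) (λ t′ → cross i i′ t t′ i≢i′)

  A : Subset m
  A = E zero zero

  u : Fin m
  u = proj₁ (e-meets zero zero)

  u∈e∩A : u ∈ e × u ∈ A
  u∈e∩A = x∈p∩q⁻ e A (proj₂ (e-meets zero zero))

  outside : ∃ λ x → x ∈ A × x ∉ e
  outside = ∃∈∖-of-single-meeting (≤-trans 2≤r (≤-reflexive (sym (∣E∣≡r zero zero)))) (proj₂ u∈e∩A)
    (λ y∈A y∈e → Transversal.meets-once e ∣e∣≡r (E zero) (E-disjoint zero) (e-meets zero)
                   y∈A y∈e (proj₂ u∈e∩A) (proj₁ u∈e∩A))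

  x : Fin m
  x = proj₁ outside

  T : Fin (suc s) → Fin r
  T zero    = zero
  T (suc i) = proj₁ (Through.covers zero zero (suc i) (λ ()) (proj₁ (proj₂ outside)))

  x∈E : ∀ i → x ∈ E i (T i)
  x∈E zero    = proj₁ (proj₂ outside)
  x∈E (suc i) = proj₂ (Through.covers zero zero (suc i) (λ ()) (proj₁ (proj₂ outside)))

  c : Fin (suc s) → Fin m
  c i = proj₁ (e-meets i (T i))

  c∈ : ∀ i → c i ∈ e × c i ∈ E i (T i)
  c∈ i = x∈p∩q⁻ e (E i (T i)) (proj₂ (e-meets i (T i)))

  c-injective : Injective _≡_ _≡_ c
  c-injective {i} {i′} ci≡ci′ with i ≟ᶠ i′
  ... | yes i≡i′ = i≡i′
  ... | no  i≢i′ = contradiction (subst (_∈ e) (sym x≡ci′) (proj₁ (c∈ i′))) (proj₂ (proj₂ outside))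
    where
    x≡ci′ : x ≡ c i′
    x≡ci′ = Through.meets-once i (T i) i′ i≢i′ (x∈E i′) (x∈E i) (proj₂ (c∈ i′))
              (subst (_∈ E i (T i)) ci≡ci′ (proj₂ (c∈ i)))

module _ {m n} {F : Family m n} where

  rainbow-∘ : ∀ {q p} {R : Fin q → Subset m} {φ : Fin q → Fin n} → IsRainbow F q R φ →
              (π : Fin p → Fin q) → Injective _≡_ _≡_ π → IsRainbow F p (R ∘ π) (φ ∘ π)
  rainbow-∘ (φ-injective , R-disjoint , R∈F) π π-injective =
    π-injective ∘ φ-injective , (λ l l′ l≢l′ → R-disjoint (π l) (π l′) (l≢l′ ∘ π-injective)) , R∈F ∘ π

  rainbow-◂ : ∀ {q} {R : Fin q → Subset m} {φ : Fin q → Fin n} → IsRainbow F q R φ →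
              ∀ {j} a → InJ φ j → (∀ k → Disjoint (R k) (F j a)) →
              IsRainbow F (suc q) (F j a ◂ R) (j ◂ φ)
  rainbow-◂ {R = R} {φ} (φ-injective , R-disjoint , R∈F) {j} a j∈J R∩Fja≡∅ =
    ◂-injective j∈J φ-injective , disjoint , ∈F
    where
    disjoint : ∀ l l′ → l ≢ l′ → Disjoint ((F j a ◂ R) l) ((F j a ◂ R) l′)
    disjoint zero    zero     0≢0 = contradiction refl 0≢0
    disjoint zero    (suc k′) _   = Disjoint-sym (R∩Fja≡∅ k′)
    disjoint (suc k) zero     _   = R∩Fja≡∅ k
    disjoint (suc k) (suc k′) k≢k′ = R-disjoint k k′ (k≢k′ ∘ cong suc)
    ∈F : ∀ l → ∃ λ b → F ((j ◂ φ) l) b ≡ (F j a ◂ R) l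
    ∈F zero    = a , refl
    ∈F (suc k) = R∈F k

maximal-rainbow⇒edges-meet : ∀ {m n} {F : Family m n} {q} {R : Fin q → Subset m} {φ : Fin q → Fin n} →
  IsRainbow F q R φ → IsMaxRainbowSize F q → (k : Fin q) → ∀ {j j′} a b → j ≢ j′ → InJ φ j → InJ φ j′ →
  (∀ k′ → k′ ≢ k → Disjoint (R k′) (F j a)) → (∀ k′ → k′ ≢ k → Disjoint (R k′) (F j′ b)) →
  Meets (F j a) (F j′ b)
maximal-rainbow⇒edges-meet {F = F} {suc q} {R} {φ} rainbow maximal k {j} {j′} a b j≢j′ j∈J j′∈J R∩Fja≡∅ R∩Fj′b≡∅
  with nonempty? (F j a ∩ F j′ b)
... | yes meet = meet
... | no  Fja∩Fj′b≡∅ = contradiction (maximal (suc (suc q)) _ _ larger) (n≮n (suc q))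
  where
  without-k : IsRainbow F q (R ∘ punchIn k) (φ ∘ punchIn k)
  without-k = rainbow-∘ {F = F} rainbow (punchIn k) (punchIn-injective k _ _)
  with-j′ : IsRainbow F (suc q) (F j′ b ◂ R ∘ punchIn k) (j′ ◂ φ ∘ punchIn k)
  with-j′ = rainbow-◂ without-k b (j′∈J ∘ punchIn k) (λ l → R∩Fj′b≡∅ (punchIn k l) (punchInᵢ≢i k l))
  j∉ : ∀ l → (j′ ◂ φ ∘ punchIn k) l ≢ j
  j∉ zero    = j≢j′ ∘ sym
  j∉ (suc l) = j∈J (punchIn k l)
  disjoint : ∀ l → Disjoint ((F j′ b ◂ R ∘ punchIn k) l) (F j a)
  disjoint zero    = Disjoint-sym Fja∩Fj′b≡∅
  disjoint (suc l) = R∩Fja≡∅ (punchIn k l) (punchInᵢ≢i k l)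
  larger : IsRainbow F (suc (suc q)) (F j a ◂ F j′ b ◂ R ∘ punchIn k) (j ◂ j′ ◂ φ ∘ punchIn k)
  larger = rainbow-◂ with-j′ a j∉ disjoint

lemma2p3 : (r : ℕ) → 2 ≤ r → (m n : ℕ) (F : Family m n) →
    (∀ i → IsMatchingOfSize r n (F i)) →
    (q : ℕ) (R : Fin q → Subset m) (φ : Fin q → Fin n) →
    IsRainbow F q R φ → IsMaxRainbowSize F q →
    (k : Fin q) →
    -- |T(R k)| ≤ r : any injectively listed family of elements of T(R k) has size ≤ r
    (s : ℕ) (h : Fin s → Fin n) → Injective _≡_ _≡_ h → (∀ i → InT r F R φ k (h i)) →
    s ≤ r
lemma2p3 r 2≤r m n F matching q R φ rainbow maximal k s h h-injective h∈T =
  cross-intersecting-matchings≤ 2≤r ∣Rk∣≡r E (λ i → proj₁ (matching (h i)) ∘ g i) E-disjoint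
    (λ i t → proj₁ (E-outside i t)) E-cross
  where
  ∣Rk∣≡r : ∣ R k ∣ ≡ r
  ∣Rk∣≡r with a , Fφka≡Rk ← proj₂ (proj₂ rainbow) k = subst (λ X → ∣ X ∣ ≡ r) Fφka≡Rk (proj₁ (matching (φ k)) a)
  g : Fin s → Fin r → Fin n
  g i = proj₁ (proj₂ (h∈T i))
  E : Fin s → Fin r → Subset m
  E i t = F (h i) (g i t)
  E-disjoint : ∀ i t t′ → t ≢ t′ → Disjoint (E i t) (E i t′)
  E-disjoint i t t′ t≢t′ = proj₂ (matching (h i)) (g i t) (g i t′) (t≢t′ ∘ proj₁ (proj₂ (proj₂ (h∈T i))))
  E-outside : ∀ i t → Meets (R k) (E i t) × (∀ k′ → k′ ≢ k → Disjoint (R k′) (E i t))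
  E-outside i = proj₂ (proj₂ (proj₂ (h∈T i)))
  E-cross : ∀ i i′ t t′ → i ≢ i′ → Meets (E i t) (E i′ t′)
  E-cross i i′ t t′ i≢i′ = maximal-rainbow⇒edges-meet {F = F} rainbow maximal k (g i t) (g i′ t′)
    (i≢i′ ∘ h-injective) (proj₁ (h∈T i)) (proj₁ (h∈T i′)) (proj₂ (E-outside i t)) (proj₂ (E-outside i′ t′))
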